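{- Let $\mathsf{T}$ be a rooted plane tree. The poset $\mathcal{O}(\mathsf{T}^\times)$ of ornamentations of $\mathsf{T}^\times$ is a lattice.
   Context: A rooted plane tree $\mathsf{T}$ with vertex set $\mathsf{V}$ and root ${\bf r}$ is viewed as a poset $(\mathsf{V},\leq_\mathsf{T})$ in which ${\bf r}$ is the unique minimum and each non-root vertex covers exactly its parent. $\mathsf{T}^\times$ is the forest poset on $\mathsf{V}^\times=\mathsf{V}\setminus\{{\bf r}\}$ with the induced order (its Hasse diagram is a forest). An ornament of $\mathsf{T}^\times$ is a subset of $\mathsf{V}^\times$ inducing a connected subgraph of $\mathsf{T}^\times$; it has a unique minimal element $v$, and is said to be hung at $v$. An ornamentation of $\mathsf{T}^\times$ is a function $\varrho$ from $\mathsf{V}^\times$ to ornaments such that $\varrho(v)$ is hung at $v$ for every $v$, and for all $v,v'$ the ornaments $\varrho(v),\varrho(v')$ are nested or disjoint. $\mathcal{O}(\mathsf{T}^\times)$ is the set of ornamentations ordered by $\varrho\leq\varrho'$ iff $\varrho(v)\subseteq\varrho'(v)$ for all $v\in\mathsf{V}^\times$. -}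

module Defs where

open import Data.Bool using (Bool; true)
open import Data.Fin using (Fin)
open import Data.List using (List; length; lookup)
open import Data.Product using (Σ; _×_; _,_; proj₁)
open import Data.Sum using (_⊎_)
open import Relation.Nullary using (¬_)
open import Relation.Binary.PropositionalEquality using (_≡_)
open import Relation.Binary.Construct.Closure.ReflexiveTransitive using (Star)


data Tree : Set where
  node : List Tree → Tree

data Vtx : Tree → Set where
  root  : ∀ {t} → Vtx t
  child : ∀ {ts} (i : Fin (length ts)) → Vtx (lookup ts i) → Vtx (node ts)

data _≤T_ : {t : Tree} → Vtx t → Vtx t → Set where
  root≤  : ∀ {t} {v : Vtx t} → root ≤T v
  child≤ : ∀ {ts} {i : Fin (length ts)} {u v : Vtx (lookup ts i)} →
           u ≤T v → child {ts} i u ≤T child {ts} i v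

data _⋖_ : {t : Tree} → Vtx t → Vtx t → Set where
  root⋖  : ∀ {ts} {i : Fin (length ts)} → root ⋖ child {ts} i root
  child⋖ : ∀ {ts} {i : Fin (length ts)} {u v : Vtx (lookup ts i)} →
           u ⋖ v → child {ts} i u ⋖ child {ts} i v

-- T× : the non-root vertices with the induced order / Hasse diagram.

data NonRoot : {t : Tree} → Vtx t → Set where
  nonroot : ∀ {ts} {i : Fin (length ts)} {v : Vtx (lookup ts i)} →
            NonRoot (child {ts} i v)

VX : Tree → Set
VX t = Σ (Vtx t) NonRoot

vtx : ∀ {t} → VX t → Vtx t
vtx (v , _) = v

_≤X_ : ∀ {t} → VX t → VX t → Set
u ≤X v = vtx u ≤T vtx v

Adj : ∀ {t} → VX t → VX t → Set
Adj u v = (vtx u ⋖ vtx v) ⊎ (vtx v ⋖ vtx u)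

Subset : Tree → Set
Subset t = VX t → Bool

_∈_ : ∀ {t} → VX t → Subset t → Set
v ∈ S = S v ≡ true

_⊆_ : ∀ {t} → Subset t → Subset t → Set
S ⊆ S' = ∀ u → u ∈ S → u ∈ S'

Disjoint : ∀ {t} → Subset t → Subset t → Set
Disjoint S S' = ∀ u → u ∈ S → ¬ (u ∈ S')

EdgeIn : ∀ {t} → Subset t → VX t → VX t → Set
EdgeIn S u v = u ∈ S × v ∈ S × Adj u v

Connected : ∀ {t} → Subset t → Set
Connected {t} S =
  Σ (VX t) (λ v → v ∈ S) × (∀ u v → u ∈ S → v ∈ S → Star (EdgeIn S) u v)

IsOrnamentHungAt : ∀ {t} → Subset t → VX t → Set
IsOrnamentHungAt S v = Connected S × v ∈ S × (∀ u → u ∈ S → v ≤X u)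

NestedOrDisjoint : ∀ {t} → Subset t → Subset t → Set
NestedOrDisjoint S S' = S ⊆ S' ⊎ S' ⊆ S ⊎ Disjoint S S'

record Ornamentation (t : Tree) : Set where
  field
    ρ       : VX t → Subset t
    hung    : ∀ v → IsOrnamentHungAt (ρ v) v
    laminar : ∀ v v' → NestedOrDisjoint (ρ v) (ρ v')

open Ornamentation public

_≤O_ : ∀ {t} → Ornamentation t → Ornamentation t → Set
ϱ ≤O ϱ' = ∀ v → ρ ϱ v ⊆ ρ ϱ' v

_≈O_ : ∀ {t} → Ornamentation t → Ornamentation t → Set
ϱ ≈O ϱ' = ∀ v u → ρ ϱ v u ≡ ρ ϱ' v u

-- An ornamentation ρ is the same thing as a relation "u ∈ ρ v" that is reflexive,
-- transitive, contained in the tree order and convex (closed under passing to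
-- intermediate vertices of a chain v ≤ w ≤ u): connectivity of an ornament amounts
-- to convexity because the Hasse diagram is a forest, and the nested-or-disjoint
-- condition amounts to transitivity because the vertices below a given one form a
-- chain.  Such relations are closed under intersection, which gives the meet, and
-- the reflexive-transitive closure of the union of two of them is again convex,
-- which gives the join.  The closure is computable since each of its proper steps
-- strictly increases the depth.
module Submission where

open import Defs
open import Data.Product using (∃₂)
open import Relation.Binary.Lattice using (IsLattice)

open import Level using (Level)
open import Data.Bool using (Bool; true; false; _≟_)
import Data.Fin.Properties as Fin
open import Data.Nat using (ℕ; zero; suc; _≤_; _<_; z≤n; s≤s; _+_)
open import Data.Nat.Properties using (≤-trans; ≤-reflexive; +-suc; +-monoʳ-≤; <-≤-trans; n≮n; m≤m+n)
open import Data.Product using (∃; _×_; _,_; proj₁; proj₂)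
open import Data.Sum using (_⊎_; inj₁; inj₂)
open import Function using (_∘_)
open import Relation.Nullary using (¬_; Dec; yes; no; does; contradiction)
open import Relation.Nullary.Decidable using (map′; dec-true; _⊎-dec_; _×-dec_)
open import Relation.Binary.Core using (Rel; _⇒_)
open import Relation.Binary.Definitions using (Reflexive; Transitive; Decidable; DecidableEquality)
open import Relation.Binary.Structures using (IsPartialOrder)
open import Relation.Binary.PropositionalEquality using (_≡_; refl; sym; trans; cong; subst)
open import Relation.Binary.Construct.Closure.ReflexiveTransitive using (Star; ε; _◅_; _◅◅_; reverse; gmap; fold)
open import Relation.Binary.Construct.Union using (_∪_)
open import Relation.Binary.Construct.Intersection using (_∩_)
import Relation.Binary.Construct.Union as Union
import Relation.Binary.Construct.Intersection as Intersection

private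
  variable
    ℓ : Level
    t : Tree
    a b c u v w : Vtx t

≤T-refl : v ≤T v
≤T-refl {v = root}      = root≤
≤T-refl {v = child i v} = child≤ ≤T-refl

≤T-trans : a ≤T b → b ≤T c → a ≤T c
≤T-trans root≤      _          = root≤
≤T-trans (child≤ p) (child≤ q) = child≤ (≤T-trans p q)

≤T-antisym : a ≤T b → b ≤T a → a ≡ b
≤T-antisym root≤      root≤      = refl
≤T-antisym (child≤ p) (child≤ q) = cong (child _) (≤T-antisym p q)

_≤T?_ : (a b : Vtx t) → Dec (a ≤T b)
root      ≤T? b         = yes root≤
child i a ≤T? root      = no λ ()
child i a ≤T? child j b with i Fin.≟ j
... | no i≢j  = no λ { (child≤ _) → i≢j refl }
... | yes refl = map′ child≤ (λ { (child≤ p) → p }) (a ≤T? b)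

≤T-comparable : a ≤T u → b ≤T u → a ≤T b ⊎ b ≤T a
≤T-comparable root≤      _          = inj₁ root≤
≤T-comparable (child≤ p) root≤      = inj₂ root≤
≤T-comparable (child≤ p) (child≤ q) with ≤T-comparable p q
... | inj₁ r = inj₁ (child≤ r)
... | inj₂ r = inj₂ (child≤ r)

depth : Vtx t → ℕ
depth root        = zero
depth (child i v) = suc (depth v)

depth-mono : a ≤T b → depth a ≤ depth b
depth-mono root≤      = z≤n
depth-mono (child≤ p) = s≤s (depth-mono p)

depth-strictMono : a ≤T b → ¬ b ≤T a → depth a < depth b
depth-strictMono {b = root}      root≤      b≰a = contradiction root≤ b≰a
depth-strictMono {b = child i b} root≤      b≰a = s≤s z≤n
depth-strictMono                 (child≤ p) b≰a = s≤s (depth-strictMono p (b≰a ∘ child≤))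

⋖⇒≤T : a ⋖ b → a ≤T b
⋖⇒≤T root⋖      = root≤
⋖⇒≤T (child⋖ p) = child≤ (⋖⇒≤T p)

⋖*⇒≤T : Star _⋖_ a b → a ≤T b
⋖*⇒≤T = fold _≤T_ (≤T-trans ∘ ⋖⇒≤T) ≤T-refl

≤T⇒⋖* : a ≤T b → Star _⋖_ a b
≤T⇒⋖* {b = root}      root≤      = ε
≤T⇒⋖* {b = child i b} root≤      = root⋖ ◅ gmap (child i) child⋖ (≤T⇒⋖* {b = b} root≤)
≤T⇒⋖* (child≤ p)                 = gmap (child _) child⋖ (≤T⇒⋖* p)

≤T-⋖-cases : a ⋖ b → w ≤T b → w ≤T a ⊎ w ≡ b
≤T-⋖-cases root⋖      root≤          = inj₁ root≤
≤T-⋖-cases root⋖      (child≤ root≤) = inj₂ refl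
≤T-⋖-cases (child⋖ p) root≤          = inj₁ root≤
≤T-⋖-cases (child⋖ p) (child≤ q) with ≤T-⋖-cases p q
... | inj₁ r    = inj₁ (child≤ r)
... | inj₂ refl = inj₂ refl

∃-≤T? : {P : Vtx t → Set ℓ} → (∀ a → Dec (P a)) → ∀ u → Dec (∃ λ a → a ≤T u × P a)
∃-≤T? P? root = map′ (λ p → root , root≤ , p) (λ { (root , root≤ , p) → p }) (P? root)
∃-≤T? {P = P} P? (child i u) = map′ into from (P? root ⊎-dec ∃-≤T? (P? ∘ child i) u)
  where
  into : P root ⊎ ∃ (λ a → a ≤T u × P (child i a)) → ∃ λ a → a ≤T child i u × P a
  into (inj₁ p)             = root , root≤ , p
  into (inj₂ (a , a≤u , p)) = child i a , child≤ a≤u , p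

  from : ∃ (λ a → a ≤T child i u × P a) → P root ⊎ ∃ λ a → a ≤T u × P (child i a)
  from (root , _ , p)               = inj₁ p
  from (child _ a , child≤ a≤u , p) = inj₂ (a , a≤u , p)

private
  variable
    x y z : VX t

NonRoot-irrelevant : (p q : NonRoot a) → p ≡ q
NonRoot-irrelevant nonroot nonroot = refl

NonRoot-upward : NonRoot a → a ≤T b → NonRoot b
NonRoot-upward nonroot (child≤ _) = nonroot

vtx-injective : vtx x ≡ vtx y → x ≡ y
vtx-injective {x = a , p} {y = .a , q} refl = cong (a ,_) (NonRoot-irrelevant p q)

≤X-antisym : x ≤X y → y ≤X x → x ≡ y
≤X-antisym p q = vtx-injective (≤T-antisym p q)

_≟X_ : DecidableEquality (VX t)
x ≟X y = map′ (λ (p , q) → ≤X-antisym p q) (λ { refl → ≤T-refl , ≤T-refl })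
              (vtx x ≤T? vtx y ×-dec vtx y ≤T? vtx x)

∃-≤X? : {P : VX t → Set ℓ} → (∀ x → Dec (P x)) → ∀ y → Dec (∃ λ x → x ≤X y × P x)
∃-≤X? {P = P} P? (child i a , nonroot) = map′ into from (∃-≤T? (λ b → P? (child i b , nonroot)) a)
  where
  into : ∃ (λ b → b ≤T a × P (child i b , nonroot)) → ∃ λ x → x ≤X (child i a , nonroot) × P x
  into (b , b≤a , p) = (child i b , nonroot) , child≤ b≤a , p

  from : ∃ (λ x → x ≤X (child i a , nonroot) × P x) → ∃ λ b → b ≤T a × P (child i b , nonroot)
  from ((child _ b , nonroot) , child≤ b≤a , p) = b , b≤a , p

does-true⇒ : {A : Set ℓ} (A? : Dec A) → does A? ≡ true → A
does-true⇒ (yes a) _ = a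

true-⇔⇒≡ : ∀ (p q : Bool) → (p ≡ true → q ≡ true) → (q ≡ true → p ≡ true) → p ≡ q
true-⇔⇒≡ true  _     p⇒q _   = sym (p⇒q refl)
true-⇔⇒≡ false true  _   q⇒p = q⇒p refl
true-⇔⇒≡ false false _   _   = refl

module _ {t : Tree} where

  Above : Rel (VX t) ℓ → Set ℓ
  Above R = R ⇒ _≤X_

  Convex : Rel (VX t) ℓ → Set ℓ
  Convex R = ∀ {x y z} → R x z → x ≤X y → y ≤X z → R x y

  record IsOrnamental (R : Rel (VX t) ℓ) : Set ℓ where
    field
      reflexive  : Reflexive R
      transitive : Transitive R
      above      : Above R
      convex     : Convex R

  ornamentRel : Ornamentation t → Rel (VX t) _
  ornamentRel ϱ x y = y ∈ ρ ϱ x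

  ornamentRel? : (ϱ : Ornamentation t) → Decidable (ornamentRel ϱ)
  ornamentRel? ϱ x y = ρ ϱ x y ≟ true

  EdgeIn-sym : {S : Subset t} → EdgeIn S x y → EdgeIn S y x
  EdgeIn-sym (x∈ , y∈ , inj₁ x⋖y) = y∈ , x∈ , inj₂ x⋖y
  EdgeIn-sym (x∈ , y∈ , inj₂ y⋖x) = y∈ , x∈ , inj₁ y⋖x

  -- The Hasse diagram is a forest, so the only edge entering the subtree above
  -- z is the one ending at z.
  walk-enters : (S : Subset t) → Star (EdgeIn S) x y → z ≤X y → ¬ z ≤X x → z ∈ S
  walk-enters S ε z≤y z≰x = contradiction z≤y z≰x
  walk-enters {z = z} S (_◅_ {j = x'} (_ , x'∈ , edge) rest) z≤y z≰x with vtx z ≤T? vtx x'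
  ... | no z≰x' = walk-enters S rest z≤y z≰x'
  ... | yes z≤x' with edge
  ...   | inj₂ x'⋖x = contradiction (≤T-trans z≤x' (⋖⇒≤T x'⋖x)) z≰x
  ...   | inj₁ x⋖x' with ≤T-⋖-cases x⋖x' z≤x'
  ...     | inj₁ z≤x = contradiction z≤x z≰x
  ...     | inj₂ z≡x' = subst (_∈ S) (vtx-injective (sym z≡x')) x'∈

  ornamentRel-isOrnamental : (ϱ : Ornamentation t) → IsOrnamental (ornamentRel ϱ)
  ornamentRel-isOrnamental ϱ = record
    { reflexive  = λ {x} → refl∈ x
    ; transitive = trans∈
    ; above      = λ {x} {y} → above x y
    ; convex     = convex
    }
    where
    refl∈ : ∀ x → x ∈ ρ ϱ x
    refl∈ x = proj₁ (proj₂ (hung ϱ x))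

    above : ∀ x y → y ∈ ρ ϱ x → x ≤X y
    above x = proj₂ (proj₂ (hung ϱ x))

    trans∈ : ornamentRel ϱ x y → ornamentRel ϱ y z → ornamentRel ϱ x z
    trans∈ {x = x} {y} {z} y∈ z∈ with laminar ϱ x y
    ... | inj₂ (inj₁ ρy⊆ρx) = ρy⊆ρx z z∈
    ... | inj₂ (inj₂ disj)  = contradiction (refl∈ y) (disj y y∈)
    ... | inj₁ ρx⊆ρy        =
      subst (λ x' → z ∈ ρ ϱ x') (≤X-antisym (above y x (ρx⊆ρy x (refl∈ x))) (above x y y∈)) z∈

    convex : Convex (ornamentRel ϱ)
    convex {x} {y} {z} z∈ x≤y y≤z with vtx y ≤T? vtx x
    ... | yes y≤x = subst (_∈ ρ ϱ x) (≤X-antisym {x = x} x≤y y≤x) (refl∈ x)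
    ... | no y≰x  = walk-enters (ρ ϱ x) (proj₂ (proj₁ (hung ϱ x)) x z (refl∈ x) z∈) y≤z y≰x

  chain-walk : (S : Subset t) → Star _⋖_ (vtx x) (vtx y) →
               (∀ z → x ≤X z → z ≤X y → z ∈ S) → Star (EdgeIn S) x y
  chain-walk {x = a , p} {y = .a , q} S ε _ rewrite NonRoot-irrelevant p q = ε
  chain-walk {x = a , p} S (_◅_ {j = b} a⋖b rest) interval =
    (interval (a , p) ≤T-refl (⋖*⇒≤T (a⋖b ◅ rest)) , interval _ a≤b (⋖*⇒≤T rest) , inj₁ a⋖b)
    ◅ chain-walk {x = b , NonRoot-upward p a≤b} S rest
        (λ z b≤z z≤y → interval z (≤T-trans a≤b b≤z) z≤y)
    where
    a≤b : a ≤T b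
    a≤b = ⋖⇒≤T a⋖b

  toSubset : {R : Rel (VX t) ℓ} → Decidable R → VX t → Subset t
  toSubset R? x y = does (R? x y)

  module _ {R : Rel (VX t) ℓ} (R? : Decidable R) where

    ∈-toSubset : R x y → y ∈ toSubset R? x
    ∈-toSubset {x} {y} = dec-true (R? x y)

    ∈-toSubset⁻ : y ∈ toSubset R? x → R x y
    ∈-toSubset⁻ {y} {x} = does-true⇒ (R? x y)

  module _ {R : Rel (VX t) ℓ} (R? : Decidable R) (isOrnamental : IsOrnamental R) where
    open IsOrnamental isOrnamental

    fromOrnamental : Ornamentation t
    fromOrnamental = record { ρ = ρR ; hung = hungR ; laminar = laminarR }
      where
      ρR : VX t → Subset t
      ρR = toSubset R?

      ∈ρR : R x y → y ∈ ρR x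
      ∈ρR = ∈-toSubset R?

      ∈ρR⁻ : y ∈ ρR x → R x y
      ∈ρR⁻ = ∈-toSubset⁻ R?

      walk : ∀ x y → y ∈ ρR x → Star (EdgeIn (ρR x)) x y
      walk x y y∈ = chain-walk (ρR x) (≤T⇒⋖* (above (∈ρR⁻ y∈)))
                      (λ z x≤z z≤y → ∈ρR (convex (∈ρR⁻ y∈) x≤z z≤y))

      hungR : ∀ x → IsOrnamentHungAt (ρR x) x
      hungR x = ( (x , ∈ρR reflexive)
                , λ y z y∈ z∈ → reverse (EdgeIn-sym {S = ρR x}) (walk x y y∈) ◅◅ walk x z z∈ )
              , ∈ρR reflexive
              , λ y → above ∘ ∈ρR⁻

      laminarR : ∀ x y → NestedOrDisjoint (ρR x) (ρR y)
      laminarR x y with R? x y | R? y x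
      ... | yes Rxy | _       = inj₂ (inj₁ λ z → ∈ρR ∘ transitive Rxy ∘ ∈ρR⁻)
      ... | no _    | yes Ryx = inj₁ λ z → ∈ρR ∘ transitive Ryx ∘ ∈ρR⁻
      ... | no ¬Rxy | no ¬Ryx = inj₂ (inj₂ disjoint)
        where
        disjoint : Disjoint (ρR x) (ρR y)
        disjoint z z∈x z∈y with ≤T-comparable (above (∈ρR⁻ z∈x)) (above (∈ρR⁻ z∈y))
        ... | inj₁ x≤y = ¬Rxy (convex (∈ρR⁻ z∈x) x≤y (above (∈ρR⁻ z∈y)))
        ... | inj₂ y≤x = ¬Ryx (convex (∈ρR⁻ z∈y) y≤x (above (∈ρR⁻ z∈x)))

  ∩-isOrnamental : {R S : Rel (VX t) ℓ} → IsOrnamental R → IsOrnamental S → IsOrnamental (R ∩ S)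
  ∩-isOrnamental isR isS = record
    { reflexive  = R.reflexive , S.reflexive
    ; transitive = λ (r , s) (r' , s') → R.transitive r r' , S.transitive s s'
    ; above      = R.above ∘ proj₁
    ; convex     = λ (r , s) p q → R.convex r p q , S.convex s p q
    }
    where
    module R = IsOrnamental isR
    module S = IsOrnamental isS

  ∪-above : {R S : Rel (VX t) ℓ} → Above R → Above S → Above (R ∪ S)
  ∪-above aboveR aboveS (inj₁ r) = aboveR r
  ∪-above aboveR aboveS (inj₂ s) = aboveS s

  ∪-convex : {R S : Rel (VX t) ℓ} → Convex R → Convex S → Convex (R ∪ S)
  ∪-convex convexR convexS (inj₁ r) p q = inj₁ (convexR r p q)
  ∪-convex convexR convexS (inj₂ s) p q = inj₂ (convexS s p q)

  module _ {R : Rel (VX t) ℓ} (above : Above R) where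

    Star-above : Above (Star R)
    Star-above = fold _≤X_ (≤T-trans ∘ above) ≤T-refl

    Star-convex : Convex R → Convex (Star R)
    Star-convex convex {x} ε x≤y y≤x = subst (Star R x) (≤X-antisym {x = x} x≤y y≤x) ε
    Star-convex convex (_◅_ {j = x'} r rest) x≤y y≤z
      with ≤T-comparable (Star-above rest) y≤z
    ... | inj₁ x'≤y = r ◅ Star-convex convex rest x'≤y y≤z
    ... | inj₂ y≤x' = convex r x≤y y≤x' ◅ ε

    Star-isOrnamental : Convex R → IsOrnamental (Star R)
    Star-isOrnamental convex = record
      { reflexive  = ε
      ; transitive = _◅◅_
      ; above      = Star-above
      ; convex     = Star-convex convex
      }

    StrictStep : VX t → VX t → VX t → Set ℓ
    StrictStep x z y = ¬ y ≤X x × R x y × Star R y z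

    Star-unfold : Star R x z → x ≡ z ⊎ ∃ λ y → y ≤X z × StrictStep x z y
    Star-unfold ε = inj₁ refl
    Star-unfold {x = x} (_◅_ {j = y} r rest) with vtx y ≤T? vtx x
    ... | no y≰x  = inj₂ (y , Star-above rest , y≰x , r , rest)
    ... | yes y≤x with ≤X-antisym {x = y} {y = x} y≤x (above r)
    ...   | refl = Star-unfold rest

    Star-fold : x ≡ z ⊎ ∃ (λ y → y ≤X z × StrictStep x z y) → Star R x z
    Star-fold (inj₁ refl)                = ε
    Star-fold (inj₂ (_ , _ , _ , r , s)) = r ◅ s

    -- A strict step raises the depth, so depth z - depth x bounds the recursion.
    Star?-bounded : Decidable R → ∀ n x z → depth (vtx z) ≤ n + depth (vtx x) → Dec (Star R x z)
    Star?-bounded R? zero x z bound = map′ (λ { refl → ε }) reflexive-only (x ≟X z)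
      where
      reflexive-only : Star R x z → x ≡ z
      reflexive-only s with Star-unfold s
      ... | inj₁ x≡z                      = x≡z
      ... | inj₂ (y , y≤z , y≰x , r , _) =
        contradiction (<-≤-trans (depth-strictMono (above r) y≰x) (≤-trans (depth-mono y≤z) bound))
                      (n≮n _)
    Star?-bounded R? (suc n) x z bound =
      map′ Star-fold Star-unfold (x ≟X z ⊎-dec ∃-≤X? strictStep? z)
      where
      strictStep? : ∀ y → Dec (StrictStep x z y)
      strictStep? y with vtx y ≤T? vtx x | R? x y
      ... | yes y≤x | _      = no λ (y≰x , _) → y≰x y≤x
      ... | no _    | no ¬r  = no λ (_ , r , _) → ¬r r
      ... | no y≰x  | yes r  = map′ (λ s → y≰x , r , s) (proj₂ ∘ proj₂)
                                  (Star?-bounded R? n y z bound')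
        where
        bound' : depth (vtx z) ≤ n + depth (vtx y)
        bound' = ≤-trans bound (≤-trans (≤-reflexive (sym (+-suc n _)))
                                        (+-monoʳ-≤ n (depth-strictMono (above r) y≰x)))

    Star? : Decidable R → Decidable (Star R)
    Star? R? x z = Star?-bounded R? (depth (vtx z)) x z (m≤m+n _ _)

module _ {T : Tree} where

  private
    isOrnamental : (ϱ : Ornamentation T) → IsOrnamental (ornamentRel ϱ)
    isOrnamental = ornamentRel-isOrnamental
    open IsOrnamental

  module _ (ϱ ϱ' : Ornamentation T) where

    meetRel : Rel (VX T) _
    meetRel = ornamentRel ϱ ∩ ornamentRel ϱ'

    meetRel? : Decidable meetRel
    meetRel? = Intersection.decidable (ornamentRel? ϱ) (ornamentRel? ϱ')

    meetRel-isOrnamental : IsOrnamental meetRel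
    meetRel-isOrnamental = ∩-isOrnamental (isOrnamental ϱ) (isOrnamental ϱ')

    unionRel-above : Above (ornamentRel ϱ ∪ ornamentRel ϱ')
    unionRel-above = ∪-above {R = ornamentRel ϱ} {S = ornamentRel ϱ'}
                            (above (isOrnamental ϱ)) (above (isOrnamental ϱ'))

    joinRel : Rel (VX T) _
    joinRel = Star (ornamentRel ϱ ∪ ornamentRel ϱ')

    joinRel? : Decidable joinRel
    joinRel? = Star? unionRel-above (Union.decidable (ornamentRel? ϱ) (ornamentRel? ϱ'))

    joinRel-isOrnamental : IsOrnamental joinRel
    joinRel-isOrnamental =
      Star-isOrnamental unionRel-above
        (∪-convex {R = ornamentRel ϱ} {S = ornamentRel ϱ'}
                  (convex (isOrnamental ϱ)) (convex (isOrnamental ϱ')))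

  _∧O_ : Ornamentation T → Ornamentation T → Ornamentation T
  ϱ ∧O ϱ' = fromOrnamental (meetRel? ϱ ϱ') (meetRel-isOrnamental ϱ ϱ')

  _∨O_ : Ornamentation T → Ornamentation T → Ornamentation T
  ϱ ∨O ϱ' = fromOrnamental (joinRel? ϱ ϱ') (joinRel-isOrnamental ϱ ϱ')

  ≤O-isPartialOrder : IsPartialOrder (_≈O_ {T}) _≤O_
  ≤O-isPartialOrder = record
    { isPreorder = record
      { isEquivalence = record
        { refl  = λ _ _ → refl
        ; sym   = λ p x y → sym (p x y)
        ; trans = λ p q x y → trans (p x y) (q x y)
        }
      ; reflexive = λ p x y y∈ → trans (sym (p x y)) y∈
      ; trans     = λ p q x y → q x y ∘ p x y
      }
    ; antisym = λ {ϱ} {ϱ'} p q x y → true-⇔⇒≡ (ρ ϱ x y) (ρ ϱ' x y) (p x y) (q x y)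
    }

  ∨O-supremum : ∀ ϱ ϱ' → ϱ ≤O (ϱ ∨O ϱ') × ϱ' ≤O (ϱ ∨O ϱ') ×
                         (∀ ϱ'' → ϱ ≤O ϱ'' → ϱ' ≤O ϱ'' → (ϱ ∨O ϱ') ≤O ϱ'')
  ∨O-supremum ϱ ϱ' = (λ x y y∈ → ∈∨ x y (inj₁ y∈ ◅ ε))
                   , (λ x y y∈ → ∈∨ x y (inj₂ y∈ ◅ ε))
                   , λ ϱ'' ϱ≤ ϱ'≤ x y → joinRel-least ϱ'' ϱ≤ ϱ'≤ ∘ ∈∨⁻ x y
    where
    ∈∨ : ∀ x y → joinRel ϱ ϱ' x y → y ∈ ρ (ϱ ∨O ϱ') x
    ∈∨ x y = ∈-toSubset (joinRel? ϱ ϱ') {x} {y}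

    ∈∨⁻ : ∀ x y → y ∈ ρ (ϱ ∨O ϱ') x → joinRel ϱ ϱ' x y
    ∈∨⁻ x y = ∈-toSubset⁻ (joinRel? ϱ ϱ') {y} {x}

    joinRel-least : ∀ ϱ'' → ϱ ≤O ϱ'' → ϱ' ≤O ϱ'' → joinRel ϱ ϱ' ⇒ ornamentRel ϱ''
    joinRel-least ϱ'' ϱ≤ ϱ'≤ = fold (ornamentRel ϱ'') (transitive (isOrnamental ϱ'') ∘ ∪⊆) (reflexive (isOrnamental ϱ''))
      where
      ∪⊆ : ornamentRel ϱ ∪ ornamentRel ϱ' ⇒ ornamentRel ϱ''
      ∪⊆ {x} {y} (inj₁ y∈) = ϱ≤ x y y∈
      ∪⊆ {x} {y} (inj₂ y∈) = ϱ'≤ x y y∈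

  ∧O-infimum : ∀ ϱ ϱ' → (ϱ ∧O ϱ') ≤O ϱ × (ϱ ∧O ϱ') ≤O ϱ' ×
                        (∀ ϱ'' → ϱ'' ≤O ϱ → ϱ'' ≤O ϱ' → ϱ'' ≤O (ϱ ∧O ϱ'))
  ∧O-infimum ϱ ϱ' = (λ x y → proj₁ ∘ ∈∧⁻ x y)
                  , (λ x y → proj₂ ∘ ∈∧⁻ x y)
                  , λ ϱ'' ≤ϱ ≤ϱ' x y y∈ → ∈∧ x y (≤ϱ x y y∈ , ≤ϱ' x y y∈)
    where
    ∈∧ : ∀ x y → meetRel ϱ ϱ' x y → y ∈ ρ (ϱ ∧O ϱ') x
    ∈∧ x y = ∈-toSubset (meetRel? ϱ ϱ') {x} {y}

    ∈∧⁻ : ∀ x y → y ∈ ρ (ϱ ∧O ϱ') x → meetRel ϱ ϱ' x y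
    ∈∧⁻ x y = ∈-toSubset⁻ (meetRel? ϱ ϱ') {y} {x}

proposition3p1 : (T : Tree) → ∃₂ λ (_∨_ _∧_ : Ornamentation T → Ornamentation T → Ornamentation T) → IsLattice (_≈O_ {T}) (_≤O_ {T}) _∨_ _∧_
proposition3p1 T = _∨O_ , _∧O_ , record
  { isPartialOrder = ≤O-isPartialOrder
  ; supremum       = ∨O-supremum
  ; infimum        = ∧O-infimum
  }
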